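{- Let $c$ be a clause of a CNF formula $F$. The following are equivalent: (0) $c$ is superredundant in $F$; (1) there is a set of clauses $G$ with $F \vdash G$, $G \models c$ and $c \notin G$; (2) there is a set of clauses $G$ and a clause $c' \subseteq c$ with $F \vdash G$, $G \vdash c'$ and $c \notin G$; (3) either there is a set of clauses $G$ with $F \vdash G$, $G \vdash c$ and $c \notin G$, or $F \vdash c'$ for some clause $c' \subsetneq c$; (4) either there is a set of clauses $G$ with $F \vdash G$, $G \vdash c$ and $c \notin G$, or $F \models c'$ for some clause $c' \subsetneq c$.
   Context: A CNF formula is a finite set of clauses; a clause is a finite set of literals, read as their disjunction. Tautological clauses are not allowed. Resolution: from clauses $c_1 \vee l$ and $c_2 \vee \neg l$ derive $c_1 \vee c_2$; two clauses whose resolvent would be a tautology are considered not to resolve. The resolution closure $\mathrm{ResCn}(F)$ is the set of all clauses obtainable from $F$ by zero or more resolution steps. $F \vdash d$ means $d \in \mathrm{ResCn}(F)$, and $F \vdash G$ means $G \subseteq \mathrm{ResCn}(F)$. A clause $c \in F$ is superredundant in $F$ if $\mathrm{ResCn}(F) \setminus \{c\} \models c$. -}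

module Defs where

open import Data.Nat using (ℕ)
open import Data.Bool using (Bool; not; true; false)
open import Data.Product using (Σ; ∃; _×_; _,_)
open import Data.Sum using (_⊎_)
open import Data.List using (List)
open import Data.List.Membership.Propositional using (_∈_)
open import Relation.Nullary using (¬_)
open import Relation.Binary.PropositionalEquality using (_≡_; _≢_)
open import Function.Bundles using (_⇔_)

-- Variables are natural numbers; a literal is a variable with a polarity
-- (true = positive, false = negative).
Lit : Set
Lit = ℕ × Bool

~_ : Lit → Lit
~ (v , b) = (v , not b)

-- A clause is a finite set of literals, represented by a list read up to
-- extensional (membership) equality _≋_.
Clause : Set
Clause = List Lit

_≋_ : Clause → Clause → Set
c ≋ d = ∀ x → (x ∈ c) ⇔ (x ∈ d)

_⊆ᶜ_ : Clause → Clause → Set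
c ⊆ᶜ d = ∀ {x} → x ∈ c → x ∈ d

_⊂ᶜ_ : Clause → Clause → Set
c ⊂ᶜ d = c ⊆ᶜ d × ¬ (d ⊆ᶜ c)

Tautological : Clause → Set
Tautological c = Σ Lit λ l → l ∈ c × (~ l) ∈ c

CNF : Set
CNF = List Clause

-- An arbitrary set of clauses, as a predicate.  Sets of clauses are read up
-- to ≋ (all notions below are invariant under replacing a clause by a ≋ one).
ClauseSet : Set₁
ClauseSet = Clause → Set

⟦_⟧ : CNF → ClauseSet
⟦ F ⟧ d = Σ Clause λ e → e ∈ F × e ≋ d

-- r is a resolvent of c₁ = c₁' ∨ l and c₂ = c₂' ∨ ¬l, i.e. r = c₁' ∨ c₂',
-- and it is not tautological (otherwise the clauses are considered not to resolve).
Resolvent : Clause → Clause → Clause → Set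
Resolvent c₁ c₂ r =
  Σ Lit λ l → l ∈ c₁ × (~ l) ∈ c₂ ×
    (∀ x → (x ∈ r) ⇔ ((x ∈ c₁ × x ≢ l) ⊎ (x ∈ c₂ × x ≢ (~ l)))) ×
    ¬ Tautological r

data ResCn (G : ClauseSet) : Clause → Set where
  base : ∀ {e d} → G e → e ≋ d → ResCn G d
  res  : ∀ {c₁ c₂ r} → ResCn G c₁ → ResCn G c₂ → Resolvent c₁ c₂ r → ResCn G r

_⊢_ : ClauseSet → Clause → Set
G ⊢ d = ResCn G d

_⊢ˢ_ : ClauseSet → ClauseSet → Set
F ⊢ˢ G = ∀ d → G d → ResCn F d

_∉ˢ_ : Clause → ClauseSet → Set
c ∉ˢ G = ∀ d → G d → ¬ (d ≋ c)

Assignment : Set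
Assignment = ℕ → Bool

SatLit : Assignment → Lit → Set
SatLit α (v , b) = α v ≡ b

SatClause : Assignment → Clause → Set
SatClause α c = Σ Lit λ l → l ∈ c × SatLit α l

_⊨_ : ClauseSet → Clause → Set
G ⊨ c = ∀ (α : Assignment) → (∀ d → G d → SatClause α d) → SatClause α c

Superredundant : CNF → Clause → Set
Superredundant F c = (λ d → ResCn ⟦ F ⟧ d × ¬ (d ≋ c)) ⊨ c

WellFormed : CNF → Set
WellFormed F = ∀ c → c ∈ F → ¬ Tautological c

{-# OPTIONS --safe #-}
module Submission where

-- The proof rests on the subsumption theorem: if a finite set of clauses H
-- entails a non-tautological clause e, some subclause of e is derivable from H.
-- Split on the variables of H: once e mentions all of them, either e contains
-- a clause of H or the assignment falsifying e is a model of H; the results for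
-- u ∨ e and ¬u ∨ e combine by resolving on u.
-- (0) ⇒ (2): ResCn(F) is finite up to ≋ (saturate F under resolution, keeping
-- one canonical representative per clause), so the theorem applies to the
-- finite set ResCn(F) \ {c}, which entails c.
-- (4) ⇒ (0): the theorem turns F ⊨ c' into F ⊢ c'' with c'' ⊆ c' ⊂ c, and such
-- a c'' lies in ResCn(F) \ {c} and entails c.
-- The remaining implications follow from soundness of resolution.

open import Defs
open import Data.Bool using (Bool; true; false; not)
import Data.Bool.Properties as Bool
open import Data.Empty using (⊥-elim)
open import Data.List using (List; []; _∷_; _++_; filter; map; concat; concatMap; length)
import Data.List.Properties as List
open import Data.List.Membership.Propositional using (_∈_; _∉_; find; lose)
open import Data.List.Membership.Propositional.Properties
  using ( ∈-filter⁺; ∈-filter⁻; ∈-++⁺ˡ; ∈-++⁺ʳ; ∈-++⁻; ∈-map⁺; ∈-map⁻; ∈-concat⁺′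
        ; ∈-concatMap⁺; ∈-concatMap⁻)
open import Data.List.Relation.Binary.Subset.Propositional using (_⊆_)
open import Data.List.Relation.Unary.All using (all?)
import Data.List.Relation.Unary.All as All
open import Data.List.Relation.Unary.All.Properties using (¬All⇒Any¬)
open import Data.List.Relation.Unary.Any using (here; there; any?)
open import Data.Nat using (ℕ; _≤_; _<_; z≤n; s≤s)
import Data.Nat as ℕ
open import Data.Nat.Induction using (<-wellFounded)
open import Data.Nat.Properties using (m≤n⇒m≤1+n)
open import Data.Product using (Σ; _×_; _,_; proj₁; proj₂; uncurry)
open import Data.Product.Function.NonDependent.Propositional using (_×-⇔_)
import Data.Product.Properties as Product
open import Data.Sum using (_⊎_; inj₁; inj₂; [_,_]′)
import Data.Sum as Sum
open import Data.Sum.Function.Propositional using (_⊎-⇔_)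
open import Function using (_∘_; id)
open import Function.Bundles using (_⇔_; mk⇔; Equivalence)
open import Function.Construct.Composition using (_⇔-∘_)
open import Function.Construct.Identity using (⇔-id)
open import Function.Construct.Symmetry using (⇔-sym)
open import Level using (0ℓ)
open import Induction.WellFounded using (Acc; acc)
open import Relation.Binary.Definitions using (DecidableEquality)
open import Relation.Binary.PropositionalEquality using (_≡_; _≢_; refl; sym; trans; cong; subst)
open import Relation.Nullary using (¬_; Dec; yes; no; does)
open import Relation.Nullary.Decidable using (¬?; _×-dec_; _⊎-dec_; map′)
open import Relation.Unary using (Pred; Decidable)

open Equivalence using (to; from)

module _ {A : Set} {P Q : Pred A 0ℓ} (P? : Decidable P) (Q? : Decidable Q)
         (P⇒Q : ∀ {x} → P x → Q x) where

  length-filter-mono : ∀ xs → length (filter P? xs) ≤ length (filter Q? xs)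
  length-filter-mono [] = z≤n
  length-filter-mono (x ∷ xs) with P? x | Q? x
  ... | yes _  | yes _  = s≤s (length-filter-mono xs)
  ... | yes px | no ¬qx = ⊥-elim (¬qx (P⇒Q px))
  ... | no _   | yes _  = m≤n⇒m≤1+n (length-filter-mono xs)
  ... | no _   | no _   = length-filter-mono xs

  length-filter-< : ∀ {y} xs → y ∈ xs → Q y → ¬ P y →
                    length (filter P? xs) < length (filter Q? xs)
  length-filter-< (x ∷ xs) (here refl) qy ¬py with P? x | Q? x
  ... | yes py | _      = ⊥-elim (¬py py)
  ... | no _   | yes _  = s≤s (length-filter-mono xs)
  ... | no _   | no ¬qy = ⊥-elim (¬qy qy)
  length-filter-< (x ∷ xs) (there y∈xs) qy ¬py with P? x | Q? x
  ... | yes _  | yes _  = s≤s (length-filter-< xs y∈xs qy ¬py)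
  ... | yes px | no ¬qx = ⊥-elim (¬qx (P⇒Q px))
  ... | no _   | yes _  = m≤n⇒m≤1+n (length-filter-< xs y∈xs qy ¬py)
  ... | no _   | no _   = length-filter-< xs y∈xs qy ¬py

sublists : {A : Set} → List A → List (List A)
sublists [] = [] ∷ []
sublists (x ∷ xs) = map (x ∷_) (sublists xs) ++ sublists xs

filter∈sublists : {A : Set} {P : Pred A 0ℓ} (P? : Decidable P) (xs : List A) →
                  filter P? xs ∈ sublists xs
filter∈sublists P? [] = here refl
filter∈sublists P? (x ∷ xs) with does (P? x)
... | true  = ∈-++⁺ˡ (∈-map⁺ (x ∷_) (filter∈sublists P? xs))
... | false = ∈-++⁺ʳ (map (x ∷_) (sublists xs)) (filter∈sublists P? xs)

∈-∷-≢ : {A : Set} {x y : A} {xs : List A} → y ∈ x ∷ xs → y ≢ x → y ∈ xs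
∈-∷-≢ (here refl) y≢x = ⊥-elim (y≢x refl)
∈-∷-≢ (there y∈xs) _ = y∈xs

_≟ˡ_ : DecidableEquality Lit
_≟ˡ_ = Product.≡-dec ℕ._≟_ Bool._≟_

_≟ᶜ_ : DecidableEquality Clause
_≟ᶜ_ = List.≡-dec _≟ˡ_

open import Data.List.Membership.DecPropositional _≟ˡ_ using () renaming (_∈?_ to _∈ˡ?_)
open import Data.List.Membership.DecPropositional _≟ᶜ_ using () renaming (_∈?_ to _∈ᶜ?_)
open import Data.List.Relation.Binary.Subset.DecPropositional _≟ˡ_ using (_⊆?_)

≋-refl : ∀ {c} → c ≋ c
≋-refl x = ⇔-id _

≋-sym : ∀ {c d} → c ≋ d → d ≋ c
≋-sym c≋d x = ⇔-sym (c≋d x)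

≋-trans : ∀ {c d e} → c ≋ d → d ≋ e → c ≋ e
≋-trans c≋d d≋e x = d≋e x ⇔-∘ c≋d x

≋⇒⊆ : ∀ {c d} → c ≋ d → c ⊆ᶜ d
≋⇒⊆ c≋d = to (c≋d _)

⊆-antisym : ∀ {c d} → c ⊆ᶜ d → d ⊆ᶜ c → c ≋ d
⊆-antisym c⊆d d⊆c x = mk⇔ c⊆d d⊆c

_≋?_ : (c d : Clause) → Dec (c ≋ d)
c ≋? d = map′ (uncurry (⊆-antisym {c} {d}))
              (λ c≋d → ≋⇒⊆ c≋d , ≋⇒⊆ (≋-sym c≋d))
              (c ⊆? d ×-dec d ⊆? c)

Tautological-mono : ∀ {c d} → c ⊆ᶜ d → Tautological c → Tautological d
Tautological-mono c⊆d (l , l∈c , ~l∈c) = l , c⊆d l∈c , c⊆d ~l∈c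

tautological? : (c : Clause) → Dec (Tautological c)
tautological? c = map′ find (λ (l , l∈c , ~l∈c) → lose l∈c ~l∈c) (any? (λ l → (~ l) ∈ˡ? c) c)

SatClause-mono : ∀ {α c d} → c ⊆ᶜ d → SatClause α c → SatClause α d
SatClause-mono c⊆d (l , l∈c , αl) = l , c⊆d l∈c , αl

satClause? : (α : Assignment) (c : Clause) → Dec (SatClause α c)
satClause? α c = map′ find (λ (l , l∈c , αl) → lose l∈c αl)
                      (any? (λ l → α (proj₁ l) Bool.≟ proj₂ l) c)

sound : ∀ {G d} → G ⊢ d → G ⊨ d
sound (base Ge e≋d) α αG = SatClause-mono (≋⇒⊆ e≋d) (αG _ Ge)
sound (res D₁ D₂ (l , _ , _ , spec , _)) α αG with sound D₁ α αG | sound D₂ α αG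
... | x , x∈c₁ , αx | y , y∈c₂ , αy with x ≟ˡ l | y ≟ˡ (~ l)
... | no x≢l   | _         = x , from (spec x) (inj₁ (x∈c₁ , x≢l)) , αx
... | yes _    | no y≢~l   = y , from (spec y) (inj₂ (y∈c₂ , y≢~l)) , αy
... | yes refl | yes refl  = ⊥-elim (Bool.not-¬ αx αy)

Resolvent-≋ : ∀ {c₁ c₂ r r'} → Resolvent c₁ c₂ r → r ≋ r' → Resolvent c₁ c₂ r'
Resolvent-≋ (l , l∈c₁ , ~l∈c₂ , spec , ¬taut) r≋r' =
  l , l∈c₁ , ~l∈c₂ , (λ x → spec x ⇔-∘ ⇔-sym (r≋r' x)) ,
  ¬taut ∘ Tautological-mono (≋⇒⊆ (≋-sym r≋r'))

⊢-≋ : ∀ {G d d'} → G ⊢ d → d ≋ d' → G ⊢ d'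
⊢-≋ (base Ge e≋d) d≋d' = base Ge (≋-trans e≋d d≋d')
⊢-≋ (res D₁ D₂ R) d≋d' = res D₁ D₂ (Resolvent-≋ R d≋d')

⊢-cut : ∀ {F G d} → F ⊢ˢ G → G ⊢ d → F ⊢ d
⊢-cut F⊢G (base Ge e≋d) = ⊢-≋ (F⊢G _ Ge) e≋d
⊢-cut F⊢G (res D₁ D₂ R) = res (⊢-cut F⊢G D₁) (⊢-cut F⊢G D₂) R

resolve : Clause → Clause → Lit → Clause
resolve a b l = filter (λ x → ¬? (x ≟ˡ l)) a ++ filter (λ x → ¬? (x ≟ˡ (~ l))) b

resolve-spec : ∀ a b l x → (x ∈ resolve a b l) ⇔ ((x ∈ a × x ≢ l) ⊎ (x ∈ b × x ≢ (~ l)))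
resolve-spec a b l x = mk⇔
  (Sum.map (∈-filter⁻ (λ x → ¬? (x ≟ˡ l))) (∈-filter⁻ (λ x → ¬? (x ≟ˡ (~ l))))
     ∘ ∈-++⁻ (filter (λ x → ¬? (x ≟ˡ l)) a))
  [ (λ (x∈a , x≢l) → ∈-++⁺ˡ (∈-filter⁺ (λ x → ¬? (x ≟ˡ l)) x∈a x≢l))
  , (λ (x∈b , x≢~l) → ∈-++⁺ʳ _ (∈-filter⁺ (λ x → ¬? (x ≟ˡ (~ l))) x∈b x≢~l)) ]′

resolvent : ∀ {a b l} → l ∈ a → (~ l) ∈ b → ¬ Tautological (resolve a b l) →
            Resolvent a b (resolve a b l)
resolvent {a} {b} {l} l∈a ~l∈b ¬taut = l , l∈a , ~l∈b , resolve-spec a b l , ¬taut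

resolve-≋ : ∀ {a a' b b' l r} → a ≋ a' → b ≋ b' →
            (∀ x → (x ∈ r) ⇔ ((x ∈ a' × x ≢ l) ⊎ (x ∈ b' × x ≢ (~ l)))) →
            resolve a b l ≋ r
resolve-≋ {a} {b = b} {l = l} a≋a' b≋b' spec x =
  ⇔-sym (spec x) ⇔-∘ (((a≋a' x ×-⇔ ⇔-id _) ⊎-⇔ (b≋b' x ×-⇔ ⇔-id _)) ⇔-∘ resolve-spec a b l x)

resolve-⊆ : ∀ {x e e₁ e₂} → e₁ ⊆ᶜ (x ∷ e) → e₂ ⊆ᶜ ((~ x) ∷ e) → resolve e₁ e₂ x ⊆ᶜ e
resolve-⊆ {x} {_} {e₁} {e₂} e₁⊆ e₂⊆ {y} y∈r =
  [ (λ (y∈e₁ , y≢x) → ∈-∷-≢ (e₁⊆ y∈e₁) y≢x)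
  , (λ (y∈e₂ , y≢~x) → ∈-∷-≢ (e₂⊆ y∈e₂) y≢~x) ]′ (to (resolve-spec e₁ e₂ x y) y∈r)

Occurs : ℕ → Clause → Set
Occurs v e = Σ Bool λ b → (v , b) ∈ e

occurs? : ∀ v e → Dec (Occurs v e)
occurs? v e = map′ [ (true ,_) , (false ,_) ]′
                   (λ { (true , p) → inj₁ p ; (false , p) → inj₂ p })
                   ((v , true) ∈ˡ? e ⊎-dec (v , false) ∈ˡ? e)

Tautological-∷ : ∀ {u b e} → ¬ Occurs u e → Tautological ((u , b) ∷ e) → Tautological e
Tautological-∷ _ (_ , here refl , here ~l≡l) = ⊥-elim (Bool.not-¬ refl (sym (cong proj₂ ~l≡l)))
Tautological-∷ u∉e (_ , here refl , there ~u∈e) = ⊥-elim (u∉e (_ , ~u∈e))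
Tautological-∷ u∉e (_ , there l∈e , here refl) = ⊥-elim (u∉e (_ , l∈e))
Tautological-∷ _ (l , there l∈e , there ~l∈e) = l , l∈e , ~l∈e

falsifier : Clause → Assignment
falsifier [] v = true
falsifier ((w , b) ∷ e) v with v ℕ.≟ w
... | yes _ = not b
... | no _  = falsifier e v

falsifier-spec : ∀ e → ¬ Tautological e → ∀ {v b} → (v , b) ∈ e → falsifier e v ≡ not b
falsifier-spec ((w , b') ∷ e) _ {v} (here refl) with v ℕ.≟ v
... | yes _   = refl
... | no v≢v  = ⊥-elim (v≢v refl)
falsifier-spec ((w , b') ∷ e) ¬taut {v} {b} (there vb∈e) with v ℕ.≟ w
... | no _ = falsifier-spec e (¬taut ∘ Tautological-mono there) vb∈e
... | yes refl with b Bool.≟ b'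
...   | yes refl = refl
...   | no b≢b'  =
  ⊥-elim (¬taut (_ , here refl , there (subst (λ b → (v , b) ∈ e) (Bool.¬-not b≢b') vb∈e)))

falsifier-falsifies : ∀ e → ¬ Tautological e → ¬ SatClause (falsifier e) e
falsifier-falsifies e ¬taut (_ , vb∈e , αv≡b) = Bool.not-¬ αv≡b (falsifier-spec e ¬taut vb∈e)

falsified⇒⊆ : ∀ {d e} → ¬ Tautological e → (∀ {v b} → (v , b) ∈ d → Occurs v e) →
              ¬ SatClause (falsifier e) d → d ⊆ᶜ e
falsified⇒⊆ {e = e} ¬taut d-in-e ¬sat {v , b} vb∈d with d-in-e vb∈d
... | b' , vb'∈e with b Bool.≟ b'
...   | yes refl = vb'∈e
...   | no b≢b'  =
  ⊥-elim (¬sat (_ , vb∈d , trans (falsifier-spec e ¬taut vb'∈e) (sym (Bool.¬-not b≢b'))))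

module _ (G : ClauseSet) where

  SubsumedOrRefuted : Clause → Set
  SubsumedOrRefuted e = (Σ Clause λ e' → e' ⊆ᶜ e × G ⊢ e')
                      ⊎ (Σ Assignment λ α → (∀ d → G d → SatClause α d) × ¬ SatClause α e)

  split-on-variable : ∀ {u e} → ¬ Tautological e → SubsumedOrRefuted ((u , true) ∷ e) →
                      SubsumedOrRefuted ((u , false) ∷ e) → SubsumedOrRefuted e
  split-on-variable _ (inj₂ (α , αG , ¬αe)) _ = inj₂ (α , αG , ¬αe ∘ SatClause-mono there)
  split-on-variable _ (inj₁ _) (inj₂ (α , αG , ¬αe)) = inj₂ (α , αG , ¬αe ∘ SatClause-mono there)
  split-on-variable {u} {e} ¬taut (inj₁ (e₁ , e₁⊆ , D₁)) (inj₁ (e₂ , e₂⊆ , D₂))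
    with (u , true) ∈ˡ? e₁ | (u , false) ∈ˡ? e₂
  ... | no pos∉e₁ | _         = inj₁ (e₁ , (λ p → ∈-∷-≢ (e₁⊆ p) (λ { refl → pos∉e₁ p })) , D₁)
  ... | yes _     | no neg∉e₂ = inj₁ (e₂ , (λ p → ∈-∷-≢ (e₂⊆ p) (λ { refl → neg∉e₂ p })) , D₂)
  ... | yes pos∈e₁ | yes neg∈e₂ =
    inj₁ (_ , r⊆e , res D₁ D₂ (resolvent pos∈e₁ neg∈e₂ (¬taut ∘ Tautological-mono r⊆e)))
    where
    r⊆e : resolve e₁ e₂ (u , true) ⊆ᶜ e
    r⊆e = resolve-⊆ e₁⊆ e₂⊆

module _ (H : CNF) where

  variables : List ℕ
  variables = map proj₁ (concat H)

  subsumed-or-refuted-total : ∀ e → ¬ Tautological e → (∀ {v} → v ∈ variables → Occurs v e) →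
                              SubsumedOrRefuted ⟦ H ⟧ e
  subsumed-or-refuted-total e ¬taut total with all? (satClause? (falsifier e)) H
  ... | yes sat = inj₂ (falsifier e , satisfies , falsifier-falsifies e ¬taut)
    where
    satisfies : ∀ d → ⟦ H ⟧ d → SatClause (falsifier e) d
    satisfies d (d' , d'∈H , d'≋d) = SatClause-mono (≋⇒⊆ d'≋d) (All.lookup sat d'∈H)
  ... | no ¬sat with find (¬All⇒Any¬ (satClause? (falsifier e)) H ¬sat)
  ...   | d , d∈H , ¬sat-d = inj₁ (d , d⊆e , base (d , d∈H , ≋-refl) ≋-refl)
    where
    d⊆e : d ⊆ᶜ e
    d⊆e = falsified⇒⊆ ¬taut (λ vb∈d → total (∈-map⁺ proj₁ (∈-concat⁺′ vb∈d d∈H))) ¬sat-d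

  subsumed-or-refuted : ∀ U e → ¬ Tautological e → (∀ {v} → v ∈ variables → Occurs v e ⊎ v ∈ U) →
                        SubsumedOrRefuted ⟦ H ⟧ e
  subsumed-or-refuted [] e ¬taut covered =
    subsumed-or-refuted-total e ¬taut ([ id , (λ ()) ]′ ∘ covered)
  subsumed-or-refuted (u ∷ U) e ¬taut covered with occurs? u e
  ... | yes u∈e = subsumed-or-refuted U e ¬taut
        ([ inj₁ , (λ { (here refl) → inj₁ u∈e ; (there v∈U) → inj₂ v∈U }) ]′ ∘ covered)
  ... | no u∉e = split-on-variable ⟦ H ⟧ ¬taut (branch true) (branch false)
    where
    branch : ∀ b → SubsumedOrRefuted ⟦ H ⟧ ((u , b) ∷ e)
    branch b = subsumed-or-refuted U _ (¬taut ∘ Tautological-∷ u∉e)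
      ([ (λ (b' , p) → inj₁ (b' , there p))
       , (λ { (here refl) → inj₁ (b , here refl) ; (there v∈U) → inj₂ v∈U }) ]′ ∘ covered)

subsumption : (H : CNF) {e : Clause} → ¬ Tautological e → ⟦ H ⟧ ⊨ e →
              Σ Clause λ e' → e' ⊆ᶜ e × ⟦ H ⟧ ⊢ e'
subsumption H ¬taut H⊨e with subsumed-or-refuted H (variables H) _ ¬taut inj₂
... | inj₁ subsumed = subsumed
... | inj₂ (α , αH , ¬αe) = ⊥-elim (¬αe (H⊨e α αH))

module Saturation (F : CNF) where

  literals : List Lit
  literals = concat F

  derivable-⊆-literals : ∀ {d} → ⟦ F ⟧ ⊢ d → d ⊆ᶜ literals
  derivable-⊆-literals (base (e , e∈F , e≋d) e≋d') x∈d =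
    ∈-concat⁺′ (from (e≋d _) (from (e≋d' _) x∈d)) e∈F
  derivable-⊆-literals (res D₁ D₂ (_ , _ , _ , spec , _)) {x} x∈r =
    [ derivable-⊆-literals D₁ ∘ proj₁ , derivable-⊆-literals D₂ ∘ proj₁ ]′ (to (spec x) x∈r)

  canonical : Clause → Clause
  canonical r = filter (_∈ˡ? r) literals

  canonical-≋ : ∀ {r} → r ⊆ᶜ literals → canonical r ≋ r
  canonical-≋ {r} r⊆ x =
    mk⇔ (proj₂ ∘ ∈-filter⁻ (_∈ˡ? r) {xs = literals}) (λ x∈r → ∈-filter⁺ (_∈ˡ? r) (r⊆ x∈r) x∈r)

  canonical-clauses : List Clause
  canonical-clauses = sublists literals

  Resolves : Clause → Clause → Lit → Set
  Resolves a b l = (~ l) ∈ b × ¬ Tautological (resolve a b l)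

  resolves? : ∀ a b → Decidable (Resolves a b)
  resolves? a b l = ((~ l) ∈ˡ? b) ×-dec ¬? (tautological? (resolve a b l))

  resolvents : List Clause → List Clause
  resolvents S = concatMap (λ a → concatMap (λ b →
    map (λ l → canonical (resolve a b l)) (filter (resolves? a b) a)) S) S

  data ResolventOf (S : List Clause) : Clause → Set where
    resolvent-of : ∀ {a b l} → a ∈ S → b ∈ S → l ∈ a → Resolves a b l →
                   ResolventOf S (canonical (resolve a b l))

  resolvents⁺ : ∀ {S x} → ResolventOf S x → x ∈ resolvents S
  resolvents⁺ {S} (resolvent-of {a} {b} {l} a∈S b∈S l∈a resolves) =
    ∈-concatMap⁺ _ (lose a∈S (∈-concatMap⁺ _ (lose b∈S
      (∈-map⁺ (λ l → canonical (resolve a b l)) (∈-filter⁺ (resolves? a b) l∈a resolves)))))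

  resolvents⁻ : ∀ {S x} → x ∈ resolvents S → ResolventOf S x
  resolvents⁻ {S} x∈ with find (∈-concatMap⁻ _ {xs = S} x∈)
  ... | a , a∈S , x∈a with find (∈-concatMap⁻ _ {xs = S} x∈a)
  ...   | b , b∈S , x∈ab with ∈-map⁻ _ x∈ab
  ...     | l , l∈ , refl with ∈-filter⁻ (resolves? a b) l∈
  ...       | l∈a , resolves = resolvent-of a∈S b∈S l∈a resolves

  record Derived (S : List Clause) : Set where
    field
      derivable  : ∀ {s} → s ∈ S → ⟦ F ⟧ ⊢ s
      includes-F : F ⊆ S
  open Derived

  Closed : List Clause → Set
  Closed S = resolvents S ⊆ S

  ResolventOf-derivable : ∀ {S x} → Derived S → ResolventOf S x → ⟦ F ⟧ ⊢ x
  ResolventOf-derivable der (resolvent-of a∈S b∈S l∈a (~l∈b , ¬taut)) =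
    ⊢-≋ D (≋-sym (canonical-≋ (derivable-⊆-literals D)))
    where
    D = res (derivable der a∈S) (derivable der b∈S) (resolvent l∈a ~l∈b ¬taut)

  ResolventOf-canonical : ∀ {S x} → ResolventOf S x → x ∈ canonical-clauses
  ResolventOf-canonical (resolvent-of {a} {b} {l} _ _ _ _) =
    filter∈sublists (_∈ˡ? resolve a b l) literals

  add-resolvents : ∀ {S} → Derived S → Derived (S ++ resolvents S)
  derivable (add-resolvents {S} der) s∈ =
    [ derivable der , ResolventOf-derivable der ∘ resolvents⁻ ]′ (∈-++⁻ S s∈)
  includes-F (add-resolvents der) = ∈-++⁺ˡ ∘ includes-F der

  missing : List Clause → ℕ
  missing S = length (filter (λ u → ¬? (u ∈ᶜ? S)) canonical-clauses)

  missing-++ : ∀ S T {x} → x ∈ canonical-clauses → x ∈ T → x ∉ S → missing (S ++ T) < missing S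
  missing-++ S T x∈can x∈T x∉S =
    length-filter-< (λ u → ¬? (u ∈ᶜ? (S ++ T))) (λ u → ¬? (u ∈ᶜ? S)) (λ u∉S++T → u∉S++T ∘ ∈-++⁺ˡ)
      canonical-clauses x∈can x∉S (λ x∉S++T → x∉S++T (∈-++⁺ʳ S x∈T))

  saturate-from : ∀ S → Derived S → Acc _<_ (missing S) → Σ (List Clause) λ S → Derived S × Closed S
  saturate-from S der (acc smaller) with all? (_∈ᶜ? S) (resolvents S)
  ... | yes closed = S , der , All.lookup closed
  ... | no ¬closed with find (¬All⇒Any¬ (_∈ᶜ? S) (resolvents S) ¬closed)
  ...   | x , x∈ , x∉S =
    saturate-from (S ++ resolvents S) (add-resolvents der) (smaller
      (missing-++ S (resolvents S) (ResolventOf-canonical (resolvents⁻ {S} x∈)) x∈ x∉S))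

  saturate : Σ (List Clause) λ S → Derived S × Closed S
  saturate = saturate-from F F-derived (<-wellFounded _)
    where
    F-derived : Derived F
    F-derived = record { derivable = λ e∈F → base (_ , e∈F , ≋-refl) ≋-refl ; includes-F = id }

  closed-complete : ∀ {S} → Derived S → Closed S → ∀ {d} → ⟦ F ⟧ ⊢ d → ⟦ S ⟧ d
  closed-complete der closed (base (e , e∈F , e≋d) e≋d') = e , includes-F der e∈F , ≋-trans e≋d e≋d'
  closed-complete der closed D@(res D₁ D₂ (l , l∈c₁ , ~l∈c₂ , spec , ¬taut))
    with closed-complete der closed D₁ | closed-complete der closed D₂
  ... | s₁ , s₁∈S , s₁≋c₁ | s₂ , s₂∈S , s₂≋c₂ =
    canonical r , closed (resolvents⁺ (resolvent-of s₁∈S s₂∈S (from (s₁≋c₁ l) l∈c₁) resolves)) ,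
    ≋-trans (canonical-≋ (derivable-⊆-literals D ∘ ≋⇒⊆ r≋)) r≋
    where
    r = resolve s₁ s₂ l
    r≋ : r ≋ _
    r≋ = resolve-≋ s₁≋c₁ s₂≋c₂ spec
    resolves : Resolves s₁ s₂ l
    resolves = from (s₂≋c₂ _) ~l∈c₂ , ¬taut ∘ Tautological-mono (≋⇒⊆ r≋)

finite-closure : (F : CNF) → Σ (List Clause) λ S → (⟦ F ⟧ ⊢ˢ ⟦ S ⟧) × (∀ d → ⟦ F ⟧ ⊢ d → ⟦ S ⟧ d)
finite-closure F =
  let S , der , closed = saturate
  in S , (λ d (e , e∈S , e≋d) → ⊢-≋ (Derived.derivable der e∈S) e≋d)
       , (λ _ → closed-complete der closed)
  where open Saturation F

remove : Clause → List Clause → List Clause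
remove c = filter (λ s → ¬? (s ≋? c))

⟦remove⟧ : ∀ c S {d} → ⟦ remove c S ⟧ d ⇔ (⟦ S ⟧ d × ¬ (d ≋ c))
⟦remove⟧ c S = mk⇔
  (λ (e , e∈ , e≋d) → let e∈S , e≉c = ∈-filter⁻ (λ s → ¬? (s ≋? c)) {xs = S} e∈
                      in (e , e∈S , e≋d) , λ d≋c → e≉c (≋-trans e≋d d≋c))
  (λ ((e , e∈S , e≋d) , d≉c) →
     e , ∈-filter⁺ (λ s → ¬? (s ≋? c)) e∈S (λ e≋c → d≉c (≋-trans (≋-sym e≋d) e≋c)) , e≋d)

EntailedWithout : CNF → Clause → Set₁
EntailedWithout F c = Σ ClauseSet λ G → (⟦ F ⟧ ⊢ˢ G) × (G ⊨ c) × (c ∉ˢ G)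

SubclauseDerivedWithout : CNF → Clause → Set₁
SubclauseDerivedWithout F c =
  Σ ClauseSet λ G → Σ Clause λ c' → (c' ⊆ᶜ c) × (⟦ F ⟧ ⊢ˢ G) × (G ⊢ c') × (c ∉ˢ G)

DerivedWithout : CNF → Clause → Set₁
DerivedWithout F c = Σ ClauseSet λ G → (⟦ F ⟧ ⊢ˢ G) × (G ⊢ c) × (c ∉ˢ G)

StrictSubclauseDerivable : CNF → Clause → Set
StrictSubclauseDerivable F c = Σ Clause λ c' → (c' ⊂ᶜ c) × (⟦ F ⟧ ⊢ c')

StrictSubclauseEntailed : CNF → Clause → Set
StrictSubclauseEntailed F c = Σ Clause λ c' → (c' ⊂ᶜ c) × (⟦ F ⟧ ⊨ c')

module _ {F : CNF} {c : Clause} where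

  superredundant⇒entailed-without : Superredundant F c → EntailedWithout F c
  superredundant⇒entailed-without sr =
    (λ d → ⟦ F ⟧ ⊢ d × ¬ (d ≋ c)) , (λ _ → proj₁) , sr , (λ _ → proj₂)

  entailed-without⇒superredundant : EntailedWithout F c → Superredundant F c
  entailed-without⇒superredundant (G , F⊢G , G⊨c , c∉G) α αF =
    G⊨c α (λ d Gd → αF d (F⊢G d Gd , c∉G d Gd))

  derived-without⇒entailed-without : DerivedWithout F c → EntailedWithout F c
  derived-without⇒entailed-without (G , F⊢G , G⊢c , c∉G) = G , F⊢G , sound G⊢c , c∉G

  superredundant⇒subclause-derived-without : ¬ Tautological c → Superredundant F c →
                                             SubclauseDerivedWithout F c
  superredundant⇒subclause-derived-without ¬taut sr =
    let S , F⊢S , S-complete = finite-closure F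
        S' = remove c S
        c' , c'⊆c , S'⊢c' = subsumption S' ¬taut λ α αS' →
          sr α λ d (F⊢d , d≉c) → αS' d (from (⟦remove⟧ c S) (S-complete d F⊢d , d≉c))
    in ⟦ S' ⟧ , c' , c'⊆c , (λ d → F⊢S d ∘ proj₁ ∘ to (⟦remove⟧ c S)) , S'⊢c' ,
       (λ d → proj₂ ∘ to (⟦remove⟧ c S))

  subclause-derived-without-cases : SubclauseDerivedWithout F c →
                                    DerivedWithout F c ⊎ StrictSubclauseDerivable F c
  subclause-derived-without-cases (G , c' , c'⊆c , F⊢G , G⊢c' , c∉G) with c ⊆? c'
  ... | yes c⊆c' = inj₁ (G , F⊢G , ⊢-≋ G⊢c' (⊆-antisym c'⊆c c⊆c') , c∉G)
  ... | no c⊈c'  = inj₂ (c' , (c'⊆c , c⊈c') , ⊢-cut F⊢G G⊢c')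

  strict-subclause-derivable⇒superredundant : StrictSubclauseDerivable F c → Superredundant F c
  strict-subclause-derivable⇒superredundant (c' , (c'⊆c , c⊈c') , F⊢c') α αF =
    SatClause-mono c'⊆c (αF c' (F⊢c' , λ c'≋c → c⊈c' (≋⇒⊆ (≋-sym c'≋c))))

  strict-subclause-derivable⇒entailed : StrictSubclauseDerivable F c → StrictSubclauseEntailed F c
  strict-subclause-derivable⇒entailed (c' , c'⊂c , F⊢c') = c' , c'⊂c , sound F⊢c'

  strict-subclause-entailed⇒derivable : ¬ Tautological c → StrictSubclauseEntailed F c →
                                        StrictSubclauseDerivable F c
  strict-subclause-entailed⇒derivable ¬taut (c' , (c'⊆c , c⊈c') , F⊨c')
    with subsumption F (¬taut ∘ Tautological-mono c'⊆c) F⊨c'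
  ... | c'' , c''⊆c' , F⊢c'' = c'' , (c'⊆c ∘ c''⊆c' , λ c⊆c'' → c⊈c' (c''⊆c' ∘ c⊆c'')) , F⊢c''

lemma6 : (F : CNF) → WellFormed F → (c : Clause) → c ∈ F →
    let S0 = Superredundant F c
        S1 = Σ ClauseSet λ G → (⟦ F ⟧ ⊢ˢ G) × (G ⊨ c) × (c ∉ˢ G)
        S2 = Σ ClauseSet λ G → Σ Clause λ c' → (c' ⊆ᶜ c) × (⟦ F ⟧ ⊢ˢ G) × (G ⊢ c') × (c ∉ˢ G)
        S3 = (Σ ClauseSet λ G → (⟦ F ⟧ ⊢ˢ G) × (G ⊢ c) × (c ∉ˢ G))
             ⊎ (Σ Clause λ c' → (c' ⊂ᶜ c) × (⟦ F ⟧ ⊢ c'))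
        S4 = (Σ ClauseSet λ G → (⟦ F ⟧ ⊢ˢ G) × (G ⊢ c) × (c ∉ˢ G))
             ⊎ (Σ Clause λ c' → (c' ⊂ᶜ c) × (⟦ F ⟧ ⊨ c'))
    in (S0 ⇔ S1) × (S0 ⇔ S2) × (S0 ⇔ S3) × (S0 ⇔ S4)
lemma6 F wf c c∈F =
    mk⇔ superredundant⇒entailed-without entailed-without⇒superredundant
  , mk⇔ s0⇒s2 (s3⇒s0 ∘ subclause-derived-without-cases)
  , mk⇔ s0⇒s3 s3⇒s0
  , mk⇔ (Sum.map₂ strict-subclause-derivable⇒entailed ∘ s0⇒s3)
        (s3⇒s0 ∘ Sum.map₂ (strict-subclause-entailed⇒derivable ¬taut))
  where
  ¬taut : ¬ Tautological c
  ¬taut = wf c c∈F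

  s0⇒s2 : Superredundant F c → SubclauseDerivedWithout F c
  s0⇒s2 = superredundant⇒subclause-derived-without ¬taut

  s0⇒s3 : Superredundant F c → DerivedWithout F c ⊎ StrictSubclauseDerivable F c
  s0⇒s3 = subclause-derived-without-cases ∘ s0⇒s2

  s3⇒s0 : DerivedWithout F c ⊎ StrictSubclauseDerivable F c → Superredundant F c
  s3⇒s0 = [ entailed-without⇒superredundant ∘ derived-without⇒entailed-without
          , strict-subclause-derivable⇒superredundant ]′
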